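{- Fix $\Join\,\in\{;,\parallel\}$. Let $\mathcal{X}$ and $\mathcal{Y}$ be elementary programs such that $|x| = |y|$ for all $x \in \mathcal{X}$ and $y \in \mathcal{Y}$. Then $\mathcal{X}^{\Join} \subseteq \mathcal{Y}^{\Join}$ if and only if $\mathcal{X} \subseteq \mathcal{Y}$.
   Context: Fix a nonempty set $E$ of events and an alphabet $\Gamma$. A partial string is a triple $p = (E_p, \alpha_p, \preceq_p)$ with $E_p \subseteq E$, $\alpha_p \colon E_p \to \Gamma$ and $\preceq_p$ a partial order on $E_p$; $\mathsf{P}_f$ is the set of finite partial strings; $|p| = |E_p|$; $\bot$ is the empty partial string. Partial strings are made disjoint by renaming events when composed. For disjoint $x,y$, $x \parallel y$ and $x ; y$ both have event set $E_x \cup E_y$ and inherited labels; $e \preceq_{x\parallel y} e'$ iff $e \preceq_x e'$ or $e \preceq_y e'$; $e \preceq_{x;y} e'$ iff ($e \in E_x$ and $e' \in E_y$) or $e \preceq_{x\parallel y} e'$. Write $x \sqsubseteq y$ if there is a bijection $f\colon E_y \to E_x$ preserving labels with $e \preceq_y e' \Rightarrow f(e) \preceq_x f(e')$. ${\downarrow}\mathcal{X} = \{y \in \mathsf{P}_f : \exists x \in \mathcal{X},\ y \sqsubseteq x\}$. A program is $\mathcal{X} \subseteq \mathsf{P}_f$ with ${\downarrow}\mathcal{X} = \mathcal{X}$. Put $1 = \{\bot\}$, $\mathcal{X} \Join \mathcal{Y} = {\downarrow}\{x \Join y : x \in \mathcal{X}, y \in \mathcal{Y}\}$. $\mathcal{P}^{\Join}$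 is the least fixed point (among programs, under $\subseteq$) of $\mathcal{Z} \mapsto 1 \cup (\mathcal{P} \Join \mathcal{Z})$. A program is elementary if it equals ${\downarrow}\mathcal{Q}$ for a finite nonempty set $\mathcal{Q} \subseteq \mathsf{P}_f$. -}

module Defs where

open import Data.Nat using (ℕ; _+_)
open import Data.Fin using (Fin; splitAt)
open import Data.Bool using (Bool; true; false; T)
open import Data.Sum using (_⊎_; inj₁; inj₂; [_,_])
open import Data.Product using (Σ; ∃; ∃₂; _×_; _,_)
open import Data.List using (List)
open import Data.List.NonEmpty using (List⁺; toList)
open import Data.List.Relation.Unary.All using (All)
open import Data.List.Membership.Propositional using (_∈_)
open import Relation.Binary.PropositionalEquality using (_≡_)
open import Relation.Unary using (Pred; _≐_)
open import Level using (0ℓ)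
open import Function.Definitions using (Bijective)

-- A finite (raw) partial string over alphabet Γ, with events named
-- 0 .. size-1 (events are taken up to renaming).
record PS (Γ : Set) : Set where
  constructor mkPS
  field
    size : ℕ
    lab  : Fin size → Γ
    ord  : Fin size → Fin size → Bool

open PS public

module _ {Γ : Set} where


  Le : (p : PS Γ) → Fin (size p) → Fin (size p) → Set
  Le p e e' = T (ord p e e')

  Valid : PS Γ → Set
  Valid p = (∀ e → Le p e e)
          × (∀ e e' → Le p e e' → Le p e' e → e ≡ e')
          × (∀ e e' e'' → Le p e e' → Le p e' e'' → Le p e e'')

  _⊑_ : PS Γ → PS Γ → Set
  x ⊑ y = Σ (Fin (size y) → Fin (size x)) λ f →
            Bijective _≡_ _≡_ f
          × (∀ e → lab x (f e) ≡ lab y e)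
          × (∀ e e' → Le y e e' → Le x (f e) (f e'))

data Op : Set where
  seqOp parOp : Op

module _ {Γ : Set} where

  private
    comb : Op → {m n : ℕ} → (Fin m → Fin m → Bool) → (Fin n → Fin n → Bool)
         → Fin m ⊎ Fin n → Fin m ⊎ Fin n → Bool
    comb _     ox oy (inj₁ i) (inj₁ j) = ox i j
    comb _     ox oy (inj₂ i) (inj₂ j) = oy i j
    comb seqOp ox oy (inj₁ i) (inj₂ j) = true
    comb parOp ox oy (inj₁ i) (inj₂ j) = false
    comb _     ox oy (inj₂ i) (inj₁ j) = false

  -- x ⋈ y on the disjoint union of events (x's events first)
  compose : Op → PS Γ → PS Γ → PS Γ
  compose op x y = mkPS (size x + size y)
    (λ k → [ lab x , lab y ] (splitAt (size x) k))
    (λ k l → comb op (ord x) (ord y) (splitAt (size x) k) (splitAt (size x) l))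

  ↓ : Pred (PS Γ) 0ℓ → Pred (PS Γ) 0ℓ
  ↓ X y = Valid y × ∃ λ x → X x × (y ⊑ x)

  Program : Pred (PS Γ) 0ℓ → Set
  Program X = X ≐ ↓ X

  One : Pred (PS Γ) 0ℓ
  One p = size p ≡ 0

  Lift : Op → Pred (PS Γ) 0ℓ → Pred (PS Γ) 0ℓ → Pred (PS Γ) 0ℓ
  Lift op X Y w = Valid w × ∃₂ λ x y → X x × Y y × (w ⊑ compose op x y)

  -- X^⋈ : least fixed point of Z ↦ 1 ∪ (X ⋈ Z), as an inductive predicate
  data Star (op : Op) (X : Pred (PS Γ) 0ℓ) : PS Γ → Set where
    base : ∀ {w} → One w → Star op X w
    step : ∀ {w} x z → X x → Star op X z → Valid w
         → w ⊑ compose op x z → Star op X w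

  Elementary : Pred (PS Γ) 0ℓ → Set
  Elementary X = Σ (List⁺ (PS Γ)) λ Q →
    All Valid (toList Q) × (X ≐ ↓ (λ x → x ∈ toList Q))

module Submission where

-- The direction X ⊆ Y ⇒ X^⋈ ⊆ Y^⋈ is monotonicity of the
-- inductively defined iteration.  For the converse, take x ∈ X.  Since
-- x ⊑ x ⋈ ⊥, x lies in X^⋈ and hence in Y^⋈.  A member of Y^⋈ is either
-- empty, or refines y ⋈ z with y ∈ Y and z ∈ Y^⋈; refinement is a bijection
-- on events, so |x| ≥ |y| + |z|.  As |x| = |y| this forces |z| = 0, so
-- x ⊑ y ⋈ ⊥ ⊑ y, and x ∈ Y because Y is downward closed.  In the empty case
-- x ⊑ q for any (equally sized, hence empty) q ∈ Y, and Y is inhabited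
-- because it is elementary.

open import Defs
open import Data.Product using (_×_)
open import Relation.Binary.PropositionalEquality using (_≡_)
open import Relation.Unary using (Pred; _⊆_)
open import Level using (0ℓ)
open import Function.Bundles using (_⇔_)

open import Data.Nat using (ℕ; _+_; _≤_)
open import Data.Nat.Properties using (+-identityʳ; +-cancelˡ-≤; n≤0⇒n≡0)
open import Data.Fin using (Fin; splitAt; _↑ˡ_)
open import Data.Fin.Properties using (splitAt-↑ˡ; splitAt⁻¹-↑ˡ; injective⇒≤)
open import Data.Sum using (inj₁; [_,_])
open import Data.Product using (∃; _,_; proj₁; proj₂)
open import Data.List.NonEmpty using (_∷_)
open import Data.List.Relation.Unary.All using (_∷_)
open import Data.List.Relation.Unary.Any using (here)
open import Function.Base using (id; _∘_)
open import Function.Bundles using (mk⇔)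
open import Function.Definitions using (Inverseᵇ)
open import Function.Consequences.Propositional
  using (inverseᵇ⇒bijective; strictlyInverseˡ⇒inverseˡ; strictlyInverseʳ⇒inverseʳ)
import Function.Construct.Composition as Composition
open import Relation.Binary.PropositionalEquality
  using (refl; sym; trans; cong; subst; subst₂)

module _ {Γ : Set} where

  ⊑-refl : (x : PS Γ) → x ⊑ x
  ⊑-refl x = id , (id , (λ i → i , id)) , (λ _ → refl) , (λ _ _ le → le)

  ⊑-trans : {x y z : PS Γ} → x ⊑ y → y ⊑ z → x ⊑ z
  ⊑-trans (f , f-bij , f-lab , f-ord) (g , g-bij , g-lab , g-ord) =
    f ∘ g ,
    Composition.bijective _≡_ _≡_ _≡_ g-bij f-bij ,
    (λ e → trans (f-lab (g e)) (g-lab e)) ,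
    (λ e e' le → f-ord (g e) (g e') (g-ord e e' le))

  ⊑-size : {x y : PS Γ} → x ⊑ y → size y ≤ size x
  ⊑-size (_ , (f-inj , _) , _) = injective⇒≤ f-inj

  ⊑-empty : (x y : PS Γ) → size x ≡ 0 → size y ≡ 0 → x ⊑ y
  ⊑-empty (mkPS .0 _ _) (mkPS .0 _ _) refl refl =
    (λ ()) , ((λ { {()} }) , (λ ())) , (λ ()) , (λ ())

  record _≅_ (x y : PS Γ) : Set where
    field
      to        : Fin (size y) → Fin (size x)
      from      : Fin (size x) → Fin (size y)
      to∘from   : ∀ i → to (from i) ≡ i
      from∘to   : ∀ j → from (to j) ≡ j
      lab-to    : ∀ j → lab x (to j) ≡ lab y j
      Le-to     : ∀ j j' → Le y j j' → Le x (to j) (to j')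
      Le-to⁻¹   : ∀ j j' → Le x (to j) (to j') → Le y j j'

  module _ {x y : PS Γ} (iso : x ≅ y) where
    open _≅_ iso

    private
      to-inverse : Inverseᵇ _≡_ _≡_ to from
      to-inverse = strictlyInverseˡ⇒inverseˡ to to∘from
                 , strictlyInverseʳ⇒inverseʳ to from∘to

      from-inverse : Inverseᵇ _≡_ _≡_ from to
      from-inverse = strictlyInverseˡ⇒inverseˡ from from∘to
                   , strictlyInverseʳ⇒inverseʳ from to∘from

    ≅⇒⊑ : x ⊑ y
    ≅⇒⊑ = to , inverseᵇ⇒bijective to-inverse , lab-to , Le-to

    ≅⇒⊒ : y ⊑ x
    ≅⇒⊒ = from , inverseᵇ⇒bijective from-inverse , lab-from , Le-from
      where
      lab-from : ∀ i → lab y (from i) ≡ lab x i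
      lab-from i = trans (sym (lab-to (from i))) (cong (lab x) (to∘from i))

      Le-from : ∀ i i' → Le x i i' → Le y (from i) (from i')
      Le-from i i' le =
        Le-to⁻¹ (from i) (from i') (subst₂ (Le x) (sym (to∘from i)) (sym (to∘from i')) le)

  -- Events of y ⋈ ⊥ are those of y, tagged on the left; this is the inverse tag.
  untagˡ : (n : ℕ) → Fin (n + 0) → Fin n
  untagˡ n k = [ id , (λ ()) ] (splitAt n k)

  untagˡ-↑ˡ : ∀ n i → untagˡ n (i ↑ˡ 0) ≡ i
  untagˡ-↑ˡ n i = cong [ id , (λ ()) ] (splitAt-↑ˡ n i 0)

  ↑ˡ-untagˡ : ∀ n k → untagˡ n k ↑ˡ 0 ≡ k
  ↑ˡ-untagˡ n k with splitAt n k in eq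
  ... | inj₁ i = splitAt⁻¹-↑ˡ eq

  compose-emptyʳ : (op : Op) (y z : PS Γ) → size z ≡ 0 → compose op y z ≅ y
  compose-emptyʳ op y (mkPS .0 l o) refl = record
    { to      = _↑ˡ 0
    ; from    = untagˡ n
    ; to∘from = ↑ˡ-untagˡ n
    ; from∘to = untagˡ-↑ˡ n
    ; lab-to  = λ j → cong [ lab y , l ] (splitAt-↑ˡ n j 0)
    ; Le-to   = Le-to
    ; Le-to⁻¹ = Le-to⁻¹
    }
    where
    n : ℕ
    n = size y

    Le-to : ∀ j j' → Le y j j' → Le (compose op y (mkPS 0 l o)) (j ↑ˡ 0) (j' ↑ˡ 0)
    Le-to j j' le rewrite splitAt-↑ˡ n j 0 | splitAt-↑ˡ n j' 0 = le

    Le-to⁻¹ : ∀ j j' → Le (compose op y (mkPS 0 l o)) (j ↑ˡ 0) (j' ↑ˡ 0) → Le y j j'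
    Le-to⁻¹ j j' le rewrite splitAt-↑ˡ n j 0 | splitAt-↑ˡ n j' 0 = le

  ε : PS Γ
  ε = mkPS 0 (λ ()) (λ ())

  program-valid : {X : Pred (PS Γ) 0ℓ} → Program X → ∀ {x} → X x → Valid x
  program-valid PX Xx = proj₁ (proj₁ PX Xx)

  program-closed : {X : Pred (PS Γ) 0ℓ} → Program X
                 → ∀ {x y} → Valid x → X y → x ⊑ y → X x
  program-closed PX vx Xy x⊑y = proj₂ PX (vx , _ , Xy , x⊑y)

  elementary-inhabited : {X : Pred (PS Γ) 0ℓ} → Elementary X → ∃ X
  elementary-inhabited ((q ∷ _) , (vq ∷ _) , X≐↓Q) =
    q , proj₂ X≐↓Q (vq , q , here refl , ⊑-refl q)

  Star-mono : (op : Op) {X Y : Pred (PS Γ) 0ℓ} → X ⊆ Y → Star op X ⊆ Star op Y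
  Star-mono op X⊆Y (base o)                = base o
  Star-mono op X⊆Y (step x z Xx Sz vw le) = step x z (X⊆Y Xx) (Star-mono op X⊆Y Sz) vw le

  -- A program is contained in its iteration, since x ⊑ x ⋈ ⊥.
  ⊆-Star : (op : Op) {X : Pred (PS Γ) 0ℓ} → Program X → X ⊆ Star op X
  ⊆-Star op PX {x} Xx =
    step x ε Xx (base refl) (program-valid PX Xx) (≅⇒⊒ (compose-emptyʳ op x ε refl))

  -- A member of Y^⋈ that has the same size as every member of the inhabited
  -- program Y already lies in Y: the iterated tail must be empty.
  Star-sameSize : (op : Op) {Y : Pred (PS Γ) 0ℓ} → Program Y → ∃ Y
                → ∀ {x} → Valid x → (∀ y → Y y → size x ≡ size y)
                → Star op Y x → Y x
  Star-sameSize op PY (q , Yq) {x} vx same (base x-empty) =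
    program-closed PY vx Yq (⊑-empty x q x-empty (trans (sym (same q Yq)) x-empty))
  Star-sameSize op PY _ {x} vx same (step y z Yy _ _ x⊑yz) =
    program-closed PY vx Yy (⊑-trans {x} {compose op y z} {y} x⊑yz (≅⇒⊑ (compose-emptyʳ op y z z-empty)))
    where
    bound : size y + size z ≤ size y + 0
    bound = subst (size y + size z ≤_)
                  (trans (same y Yy) (sym (+-identityʳ (size y))))
                  (⊑-size {x} {compose op y z} x⊑yz)

    z-empty : size z ≡ 0
    z-empty = n≤0⇒n≡0 (+-cancelˡ-≤ (size y) (size z) 0 bound)

corollary1 : {Γ : Set} (op : Op) (X Y : Pred (PS Γ) 0ℓ)
    → Program X → Program Y → Elementary X → Elementary Y
    → (∀ x y → X x → Y y → size x ≡ size y)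
    → (Star op X ⊆ Star op Y) ⇔ (X ⊆ Y)
corollary1 op X Y PX PY _ EY sameSize = mk⇔ reflect (Star-mono op)
  where
  reflect : Star op X ⊆ Star op Y → X ⊆ Y
  reflect X*⊆Y* {x} Xx =
    Star-sameSize op PY (elementary-inhabited EY) (program-valid PX Xx)
                  (λ y → sameSize x y Xx) (X*⊆Y* (⊆-Star op PX Xx))
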